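{- Let $\Pi=\hat u_{i_1}\to\hat u_{i_2}\to\dots\to\hat u_{i_k}$ be a downward path of $k$ nodes (each $\hat u_{i_{t+1}}$ a child of $\hat u_{i_t}$) such that $i_j<n$ for some $1\le j\le k$, no node of $\Pi$ other than possibly $\hat u_{i_1}$ is blue, and no node of $\Pi$ other than possibly $\hat u_{i_k}$ is red. Then $\hat u_{i_1+1}\to\hat u_{i_2+1}\to\dots\to\hat u_{i_k+1}$ is a downward path in the tree (in particular all indices $i_t+1\le n$ and each $\hat u_{i_{t+1}+1}$ is a child of $\hat u_{i_t+1}$).
   Context: A trie is a rooted tree with $n$ nodes whose edges are labeled with characters of $\Sigma$, totally ordered by $\prec$, such that the edges leaving any node carry pairwise distinct labels. $\lambda(\hat u)$ is the label of the edge entering $\hat u$ (the root gets $\#$, the smallest character, labeling no edge) and $out(\hat u)$ is the set of labels of edges leaving $\hat u$. Nodes are sorted co-lexicographically (root-to-node label strings compared right-to-left with $\prec$): $\hat u_1<\dots<\hat u_n$. For $i<n$, $\hat u_i$ is red if $out(\hat u_i)\ne out(\hat u_{i+1})$ and blue if $\lambda(\hat u_i)\ne\lambda(\hat u_{i+1})$; $\hat u_n$ is neither red nor blue. -}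

module Defs where

open import Data.Nat using (ℕ; zero; suc; _∸_; _<_)
open import Data.Fin using (Fin; toℕ)
import Data.Fin as F
open import Data.List using (List; []; _∷_; _∷ʳ_; reverse)
open import Data.Maybe using (Maybe; nothing; just)
open import Data.Product using (Σ; ∃; ∃-syntax; _×_; _,_)
open import Data.Empty using (⊥)
open import Relation.Nullary using (¬_)
open import Relation.Binary.PropositionalEquality using (_≡_; _≢_)
open import Data.List.Relation.Binary.Lex.Strict using (Lex-<)
open import Function.Bundles using (_⇔_)

-- A trie over an alphabet A (ordered by _≺_) is represented by the set of
-- its root-to-node label strings (a prefix-closed finite set containing
-- the empty string for the root); each node is identified with its string.
-- The n nodes are enumerated as node 0 < node 1 < ... < node (n-1) in
-- co-lexicographic order (0-based: node i here is û_{i+1} of the paper).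
module Tries {A : Set} (_≺_ : A → A → Set) where

  _<colex_ : List A → List A → Set
  u <colex v = Lex-< _≡_ _≺_ (reverse u) (reverse v)

  record Trie (n : ℕ) : Set where
    field
      node         : Fin n → List A
      sorted       : ∀ (i j : Fin n) → i F.< j → node i <colex node j
      hasRoot      : ∃[ r ] node r ≡ []
      prefixClosed : ∀ (i : Fin n) (w : List A) (c : A) →
                     node i ≡ w ∷ʳ c → ∃[ j ] node j ≡ w

  module _ {n : ℕ} (T : Trie n) where
    open Trie T

    Child : Fin n → Fin n → Set
    Child i j = ∃[ c ] node j ≡ node i ∷ʳ c

    -- label of the edge entering a node; nothing plays the role of #
    lastChar : List A → Maybe A
    lastChar []      = nothing
    lastChar (x ∷ []) = just x
    lastChar (x ∷ y ∷ xs) = lastChar (y ∷ xs)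

    λ' : Fin n → Maybe A
    λ' i = lastChar (node i)

    InOut : Fin n → A → Set
    InOut i c = ∃[ j ] node j ≡ node i ∷ʳ c

    SameOut : Fin n → Fin n → Set
    SameOut i i' = ∀ (c : A) → InOut i c ⇔ InOut i' c

    Next : Fin n → Fin n → Set
    Next i i' = toℕ i' ≡ suc (toℕ i)

    Red : Fin n → Set
    Red i = ∃[ i' ] (Next i i' × ¬ SameOut i i')

    Blue : Fin n → Set
    Blue i = ∃[ i' ] (Next i i' × λ' i ≢ λ' i')

    IsDownPath : (k : ℕ) → (Fin k → Fin n) → Set
    IsDownPath k ps = ∀ (t t' : Fin k) → toℕ t' ≡ suc (toℕ t) → Child (ps t) (ps t')

module Submission where

-- If û_i is not red, a c-child of û_i has a c-sibling under û_{i+1}, and that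
-- sibling is the co-lexicographic successor of the child: any node strictly
-- between the two also ends in c, so its parent would lie strictly between
-- û_i and û_{i+1}. Dually, if a c-child of û_i is not blue, its successor also
-- ends in c and has a parent beyond û_i, so û_i is not the last node. Hence
-- "the node has a successor" spreads from the j-th node of the path downwards
-- through non-red nodes and upwards through non-blue ones, and the first fact
-- then makes the successors a downward path.

open import Defs
open import Data.Nat using (ℕ; zero; suc; _∸_; _≤_; _<_; _+_)
open import Data.Nat.Properties
  using (<-trans; <-irrefl; ≤-pred; ≤-<-trans; ≤-reflexive; ≤-antisym; ≤-total; <⇒≱; ≮⇒≥;
         n<1+n; m≤m+n; +-identityʳ; +-suc; m+[n∸m]≡n; 0≢1+n)
open import Data.Fin using (Fin; toℕ; fromℕ<)
import Data.Fin as F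
open import Data.Fin.Properties using (toℕ<n; toℕ-fromℕ<; toℕ-injective; <-cmp; any?)
open import Data.List using (List; []; _∷_; _∷ʳ_; [_]; reverse)
open import Data.List.Properties using (reverse-++; reverse-involutive; unfold-reverse)
import Data.List.Properties as List
import Data.Maybe.Properties as Maybe
open import Data.Maybe using (just)
open import Data.List.Relation.Binary.Lex.Core using (this; next)
open import Data.List.Relation.Binary.Lex.Strict using (Lex-<; <-isStrictPartialOrder)
open import Data.List.Relation.Binary.Pointwise using (≡⇒Pointwise-≡)
open import Data.Product using (Σ; ∃; ∃-syntax; _×_; _,_; proj₂)
open import Data.Sum using ([_,_]′)
open import Data.Empty using (⊥; ⊥-elim)
open import Relation.Nullary using (¬_)
open import Relation.Nullary.Decidable using (decidable-stable)
open import Level using (0ℓ)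
open import Relation.Binary.Core using (Rel)
open import Relation.Binary.Definitions using (Transitive; tri<; tri≈; tri>)
open import Relation.Binary.PropositionalEquality
  using (_≡_; _≢_; refl; sym; trans; cong; subst; subst₂; module ≡-Reasoning)
open import Relation.Binary.Structures using (IsStrictPartialOrder; IsStrictTotalOrder)
open import Function.Bundles using (Equivalence)

infix 4 _⋖_

_⋖_ : ∀ {k} → Rel (Fin k) 0ℓ
t ⋖ t' = toℕ t' ≡ suc (toℕ t)

module _ {k : ℕ} where

  ⋖⇒< : ∀ {t t' : Fin k} → t ⋖ t' → t F.< t'
  ⋖⇒< t⋖t' = ≤-reflexive (sym t⋖t')

  ⋖-source-not-last : ∀ {t t' : Fin k} → t ⋖ t' → suc (toℕ t) ≢ k
  ⋖-source-not-last {t' = t'} t⋖t' 1+t≡k = <-irrefl (trans t⋖t' 1+t≡k) (toℕ<n t')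

  ⋖-target-nonzero : ∀ {t t' : Fin k} → t ⋖ t' → toℕ t' ≢ 0
  ⋖-target-nonzero t⋖t' t'≡0 = 0≢1+n (trans (sym t'≡0) t⋖t')

  ⋖-no-between : ∀ {t t' p : Fin k} → t ⋖ t' → t F.< p → p F.< t' → ⊥
  ⋖-no-between {p = p} t⋖t' t<p p<t' =
    <⇒≱ t<p (≤-pred (subst (suc (toℕ p) ≤_) t⋖t' p<t'))

  <-no-between⇒⋖ : ∀ {t t' : Fin k} → t F.< t' → (∀ p → t F.< p → p F.< t' → ⊥) →
                   t ⋖ t'
  <-no-between⇒⋖ {t} {t'} t<t' no-between = ≤-antisym (≮⇒≥ no-middle) t<t'
    where
    no-middle : ¬ suc (toℕ t) < toℕ t'
    no-middle lt =
      no-between p (≤-reflexive (sym p≡1+t)) (subst (_< toℕ t') (sym p≡1+t) lt)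
      where
      p = fromℕ< (<-trans lt (toℕ<n t'))
      p≡1+t = toℕ-fromℕ< (<-trans lt (toℕ<n t'))

  ⋖-closed⇒universal : (P : Fin k → Set) →
                       (∀ {t t'} → t ⋖ t' → P t → P t') →
                       (∀ {t t'} → t ⋖ t' → P t' → P t) →
                       ∀ {j} → P j → ∀ t → P t
  ⋖-closed⇒universal P forward backward {j} pj t =
    [ above , below ]′ (≤-total (toℕ j) (toℕ t))
    where
    At : ℕ → Set
    At m = ∀ t → toℕ t ≡ m → P t

    at-j : At (toℕ j)
    at-j t t≡j = subst P (toℕ-injective (sym t≡j)) pj

    at-suc : ∀ {m} → At m → At (suc m)
    at-suc {m} at-m t t≡1+m =
      forward (trans t≡1+m (cong suc (sym (toℕ-fromℕ< m<k)))) (at-m _ (toℕ-fromℕ< m<k))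
      where
      m<k : m < k
      m<k = <-trans (n<1+n m) (subst (_< k) t≡1+m (toℕ<n t))

    at-pred : ∀ {m} → suc m < k → At (suc m) → At m
    at-pred 1+m<k at-1+m t t≡m =
      backward (trans (toℕ-fromℕ< 1+m<k) (cong suc (sym t≡m))) (at-1+m _ (toℕ-fromℕ< 1+m<k))

    at-+ : ∀ {m} d → At m → At (m + d)
    at-+ zero    at-m = subst At (sym (+-identityʳ _)) at-m
    at-+ {m} (suc d) at-m = subst At (sym (+-suc m d)) (at-suc (at-+ d at-m))

    at-∸ : ∀ {m} d → m + d < k → At (m + d) → At m
    at-∸ zero    _  at-m = subst At (+-identityʳ _) at-m
    at-∸ {m} (suc d) lt at-m+d = at-pred (≤-<-trans (m≤m+n (suc m) d) lt')
                                         (at-∸ d lt' (subst At (+-suc m d) at-m+d))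
      where
      lt' : suc m + d < k
      lt' = subst (_< k) (+-suc m d) lt

    above : toℕ j ≤ toℕ t → P t
    above j≤t = at-+ (toℕ t ∸ toℕ j) at-j t (sym (m+[n∸m]≡n j≤t))

    below : toℕ t ≤ toℕ j → P t
    below t≤j = at-∸ (toℕ j ∸ toℕ t) (subst (_< k) (sym t+d≡j) (toℕ<n j))
                     (subst At (sym t+d≡j) at-j) t refl
      where
      t+d≡j = m+[n∸m]≡n t≤j

module Colex {A : Set} {_≺_ : A → A → Set} (spo : IsStrictPartialOrder _≡_ _≺_) where
  open Tries _≺_ using (_<colex_)
  open ≡-Reasoning
  open IsStrictPartialOrder spo using () renaming (irrefl to ≺-irrefl; trans to ≺-trans)
  private module Lex = IsStrictPartialOrder (<-isStrictPartialOrder spo)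

  <colex-trans : Transitive _<colex_
  <colex-trans = Lex.trans

  <colex-irrefl : ∀ u → ¬ u <colex u
  <colex-irrefl _ = Lex.irrefl (≡⇒Pointwise-≡ refl)

  reverse-∷ʳ : ∀ (u : List A) c → reverse (u ∷ʳ c) ≡ c ∷ reverse u
  reverse-∷ʳ u c = reverse-++ u [ c ]

  ∷ʳ-<colex-∷ʳ : ∀ {u v c} → u <colex v → (u ∷ʳ c) <colex (v ∷ʳ c)
  ∷ʳ-<colex-∷ʳ {u} {v} {c} u<v rewrite reverse-∷ʳ u c | reverse-∷ʳ v c = next refl u<v

  ∷ʳ-<colex-∷ʳ⁻¹ : ∀ {u v c} → (u ∷ʳ c) <colex (v ∷ʳ c) → u <colex v
  ∷ʳ-<colex-∷ʳ⁻¹ {u} {v} {c} uc<vc rewrite reverse-∷ʳ u c | reverse-∷ʳ v c with uc<vc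
  ... | this c≺c   = ⊥-elim (≺-irrefl refl c≺c)
  ... | next _ u<v = u<v

  Lex-<-between-∷ : ∀ {c xs ys w} → Lex-< _≡_ _≺_ (c ∷ xs) w → Lex-< _≡_ _≺_ w (c ∷ ys) →
                    ∃[ zs ] w ≡ c ∷ zs
  Lex-<-between-∷ {w = _ ∷ zs} (next refl _) _             = zs , refl
  Lex-<-between-∷             (this c≺d)    (this d≺c)    =
    ⊥-elim (≺-irrefl refl (≺-trans c≺d d≺c))
  Lex-<-between-∷             (this c≺c)    (next refl _) = ⊥-elim (≺-irrefl refl c≺c)

  <colex-between-∷ʳ : ∀ {u v w c} → (u ∷ʳ c) <colex w → w <colex (v ∷ʳ c) →
                      ∃[ x ] w ≡ x ∷ʳ c
  <colex-between-∷ʳ {u} {v} {w} {c} uc<w w<vc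
    rewrite reverse-∷ʳ u c | reverse-∷ʳ v c with Lex-<-between-∷ uc<w w<vc
  ... | zs , rev-w≡c∷zs =
    reverse zs , (begin
      w                     ≡⟨ reverse-involutive w ⟨
      reverse (reverse w)   ≡⟨ cong reverse rev-w≡c∷zs ⟩
      reverse (c ∷ zs)      ≡⟨ unfold-reverse c zs ⟩
      reverse zs ∷ʳ c       ∎)

module TrieProperties {A : Set} {_≺_ : A → A → Set} (sto : IsStrictTotalOrder _≡_ _≺_)
                      {n : ℕ} (T : Tries.Trie _≺_ n) where
  open IsStrictTotalOrder sto using (_≟_; isStrictPartialOrder)
  open Tries _≺_
  open Trie T
  open Colex isStrictPartialOrder
  open ≡-Reasoning

  <colex⇒< : ∀ i j → node i <colex node j → i F.< j
  <colex⇒< i j i<j with <-cmp i j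
  ... | tri< i<j _ _ = i<j
  ... | tri≈ _ refl _ = ⊥-elim (<colex-irrefl (node i) i<j)
  ... | tri> _ _ j<i =
    ⊥-elim (<colex-irrefl (node i) (<colex-trans {node i} {node j} {node i} i<j (sorted j i j<i)))

  parent-<⇒child-< : ∀ {i i' j j' c} → node j ≡ node i ∷ʳ c → node j' ≡ node i' ∷ʳ c →
                     i F.< i' → j F.< j'
  parent-<⇒child-< {i} {i'} {j} {j'} {c} j-child j'-child i<i' =
    <colex⇒< j j' (subst₂ _<colex_ (sym j-child) (sym j'-child)
                          (∷ʳ-<colex-∷ʳ {node i} {node i'} {c} (sorted i i' i<i')))

  child-<⇒parent-< : ∀ {i i' j j' c} → node j ≡ node i ∷ʳ c → node j' ≡ node i' ∷ʳ c →
                     j F.< j' → i F.< i'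
  child-<⇒parent-< {i} {i'} {j} {j'} {c} j-child j'-child j<j' =
    <colex⇒< i i' (∷ʳ-<colex-∷ʳ⁻¹ {node i} {node i'} {c}
                     (subst₂ _<colex_ j-child j'-child (sorted j j' j<j')))

  between-children⇒between-parents : ∀ {i i' j j' m c} →
                                     node j ≡ node i ∷ʳ c → node j' ≡ node i' ∷ʳ c →
                                     j F.< m → m F.< j' → ∃[ p ] (i F.< p × p F.< i')
  between-children⇒between-parents {i} {i'} {j} {j'} {m} {c} j-child j'-child j<m m<j'
    with <colex-between-∷ʳ {node i} {node i'} {node m} {c}
           (subst (_<colex node m) j-child (sorted j m j<m))
           (subst (node m <colex_) j'-child (sorted m j' m<j'))
  ... | x , m≡x∷c with prefixClosed m x c m≡x∷c
  ... | p , p≡x = p , child-<⇒parent-< {i} {p} {j} {m} j-child m-child j<m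
                  , child-<⇒parent-< {p} {i'} {m} {j'} m-child j'-child m<j'
    where
    m-child : node m ≡ node p ∷ʳ c
    m-child = subst (λ y → node m ≡ y ∷ʳ c) (sym p≡x) m≡x∷c

  lastChar-∷ʳ : ∀ (w : List A) c → lastChar T (w ∷ʳ c) ≡ just c
  lastChar-∷ʳ []           c = refl
  lastChar-∷ʳ (_ ∷ [])     c = refl
  lastChar-∷ʳ (_ ∷ y ∷ ws) c = lastChar-∷ʳ (y ∷ ws) c

  lastChar≡just⇒∷ʳ : ∀ (w : List A) {c} → lastChar T w ≡ just c → ∃[ u ] w ≡ u ∷ʳ c
  lastChar≡just⇒∷ʳ (x ∷ [])     refl = [] , refl
  lastChar≡just⇒∷ʳ (x ∷ y ∷ ws) eq with lastChar≡just⇒∷ʳ (y ∷ ws) eq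
  ... | u , y∷ws≡u∷c = x ∷ u , cong (x ∷_) y∷ws≡u∷c

  λ'≡just⇒has-parent : ∀ {j c} → λ' T j ≡ just c → ∃[ p ] node j ≡ node p ∷ʳ c
  λ'≡just⇒has-parent {j} {c} λj≡c with lastChar≡just⇒∷ʳ (node j) λj≡c
  ... | u , j≡u∷c with prefixClosed j u c j≡u∷c
  ... | p , p≡u = p , subst (λ y → node j ≡ y ∷ʳ c) (sym p≡u) j≡u∷c

  ¬Red⇒out-⊆ : ∀ {i i' c} → ¬ Red T i → i ⋖ i' → InOut T i c → InOut T i' c
  ¬Red⇒out-⊆ {i} {i'} {c} ¬red i⋖i' c∈out-i =
    decidable-stable (any? λ j → List.≡-dec _≟_ (node j) (node i' ∷ʳ c))
      λ c∉out-i' → ¬red (i' , i⋖i' , λ same-out →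
                     c∉out-i' (Equivalence.to (same-out c) c∈out-i))

  ¬Blue⇒λ'≡ : ∀ {j j'} → ¬ Blue T j → j ⋖ j' → λ' T j ≡ λ' T j'
  ¬Blue⇒λ'≡ {j} {j'} ¬blue j⋖j' =
    decidable-stable (Maybe.≡-dec _≟_ (λ' T j) (λ' T j'))
      λ λj≢λj' → ¬blue (j' , j⋖j' , λj≢λj')

  ¬Red⇒successor-child : ∀ {i i' j c} → ¬ Red T i → i ⋖ i' → node j ≡ node i ∷ʳ c →
                         ∃[ j' ] (node j' ≡ node i' ∷ʳ c × j ⋖ j')
  ¬Red⇒successor-child {j = j} ¬red i⋖i' j-child
    with ¬Red⇒out-⊆ ¬red i⋖i' (j , j-child)
  ... | j' , j'-child = j' , j'-child , <-no-between⇒⋖ j<j' no-between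
    where
    j<j' : j F.< j'
    j<j' = parent-<⇒child-< j-child j'-child (⋖⇒< i⋖i')

    no-between : ∀ m → j F.< m → m F.< j' → ⊥
    no-between m j<m m<j' =
      let p , i<p , p<i' = between-children⇒between-parents j-child j'-child j<m m<j'
      in ⋖-no-between i⋖i' i<p p<i'

  ¬Blue⇒parent-not-last : ∀ {i j j' c} → ¬ Blue T j → j ⋖ j' → node j ≡ node i ∷ʳ c →
                          suc (toℕ i) < n
  ¬Blue⇒parent-not-last {i} {j} {j'} {c} ¬blue j⋖j' j-child =
    let p , j'-child = λ'≡just⇒has-parent {j'} λj'≡c
    in ≤-<-trans (child-<⇒parent-< j-child j'-child (⋖⇒< j⋖j')) (toℕ<n p)
    where
    λj'≡c : λ' T j' ≡ just c
    λj'≡c = begin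
      λ' T j'                   ≡⟨ ¬Blue⇒λ'≡ ¬blue j⋖j' ⟨
      λ' T j                    ≡⟨ cong (lastChar T) j-child ⟩
      lastChar T (node i ∷ʳ c)  ≡⟨ lastChar-∷ʳ (node i) c ⟩
      just c                    ∎

lemma10 : (A : Set) (_≺_ : A → A → Set) → IsStrictTotalOrder _≡_ _≺_ →
          (n : ℕ) (T : Tries.Trie _≺_ n) →
          (k : ℕ) (ps : Fin k → Fin n) →
          Tries.IsDownPath _≺_ T k ps →
          (∃[ j ] suc (toℕ (ps j)) < n) →
          (∀ (t : Fin k) → toℕ t ≢ 0 → ¬ Tries.Blue _≺_ T (ps t)) →
          (∀ (t : Fin k) → suc (toℕ t) ≢ k → ¬ Tries.Red _≺_ T (ps t)) →
          Σ (Fin k → Fin n) (λ qs →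
            (∀ (t : Fin k) → toℕ (qs t) ≡ suc (toℕ (ps t))) ×
            Tries.IsDownPath _≺_ T k qs)
lemma10 A _≺_ sto n T k ps path (j , ps-j-not-last) ¬blue ¬red =
  qs , (λ t → toℕ-fromℕ< (not-last t)) , qs-path
  where
  open Tries _≺_
  open TrieProperties sto T

  NotLast : Fin k → Set
  NotLast t = suc (toℕ (ps t)) < n

  successor-child : ∀ {t t'} → t ⋖ t' → (nl : NotLast t) →
                    ∃[ j' ] (Child T (fromℕ< nl) j' × ps t' ⋖ j')
  successor-child {t} {t'} t⋖t' nl =
    let c , child = path t t' t⋖t'
        j' , j'-child , ps-t'⋖j' =
          ¬Red⇒successor-child (¬red t (⋖-source-not-last t⋖t')) (toℕ-fromℕ< nl) child
    in j' , (c , j'-child) , ps-t'⋖j'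

  not-last : ∀ t → NotLast t
  not-last = ⋖-closed⇒universal NotLast forward backward ps-j-not-last
    where
    forward : ∀ {t t'} → t ⋖ t' → NotLast t → NotLast t'
    forward t⋖t' nl = let j' , _ , ps-t'⋖j' = successor-child t⋖t' nl
                      in subst (_< n) ps-t'⋖j' (toℕ<n j')

    backward : ∀ {t t'} → t ⋖ t' → NotLast t' → NotLast t
    backward {t} {t'} t⋖t' nl' =
      ¬Blue⇒parent-not-last (¬blue t' (⋖-target-nonzero t⋖t')) (toℕ-fromℕ< nl')
                            (proj₂ (path t t' t⋖t'))

  qs : Fin k → Fin n
  qs t = fromℕ< (not-last t)

  qs-path : IsDownPath T k qs
  qs-path t t' t⋖t' =
    let j' , child , ps-t'⋖j' = successor-child t⋖t' (not-last t)
    in subst (Child T (qs t)) (toℕ-injective (trans ps-t'⋖j' (sym (toℕ-fromℕ< (not-last t')))))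
             child
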